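{- Let $j$ be an integer and $n$ a non-negative integer. Then \[ \sum_{k=0}^n\binom{n}{k}\frac{F_{jk-1}}{L_j^k}B_{n-k}=B_n\Big(\frac{\alpha^j}{L_j}\Big)\quad(n\text{ even}),\qquad \sum_{k=1}^n\binom{n}{k}\frac{F_{jk}}{L_j^k}B_{n-k}=0\quad(n\text{ even}), \] \[ \sum_{k=0}^n\binom{n}{k}\frac{L_{jk-1}}{L_j^k}B_{n-k}=\sqrt5\,B_n\Big(\frac{\alpha^j}{L_j}\Big)\quad(n\text{ odd}),\qquad \sum_{k=0}^n\binom{n}{k}\frac{L_{jk}}{L_j^k}B_{n-k}=0\quad(n\text{ odd}). \]
   Context: $\alpha=\frac{1+\sqrt5}{2}$, $\beta=\frac{1-\sqrt5}{2}$. For every integer $s$, $F_s=\frac{\alpha^s-\beta^s}{\sqrt5}$ and $L_s=\alpha^s+\beta^s$ (Fibonacci and Lucas numbers extended to all integers). The Bernoulli polynomials $B_n(x)$ are defined by $\sum_{n\ge0}B_n(x)\frac{z^n}{n!}=\frac{ze^{xz}}{e^z-1}$, and $B_n=B_n(0)$. -}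

module Defs where

open import Data.Nat using (ℕ; zero; suc)
import Data.Nat as ℕ
open import Data.Nat.Combinatorics using (_C_)
open import Data.Integer as ℤ using (ℤ; +_; -[1+_])
open import Data.Rational as ℚ using (ℚ; 0ℚ; 1ℚ; _/_; 1/_)
open import Data.Rational.Properties using (_≟_)
import Data.Rational.Base as ℚB
open import Data.List using (List; []; _∷_; _++_; [_]; zipWith; upTo; foldr)
open import Data.Product using (∃-syntax)
open import Relation.Binary.PropositionalEquality using (_≡_)
open import Relation.Nullary using (yes; no)

Even : ℕ → Set
Even n = ∃[ m ] n ≡ 2 ℕ.* m

Odd : ℕ → Set
Odd n = ∃[ m ] n ≡ suc (2 ℕ.* m)

-- The field ℚ(√5): elements a + b√5 with a b : ℚ (normalised rationals,
-- so propositional equality is equality of numbers).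

record ℚ√5 : Set where
  constructor _+√5·_
  field
    re : ℚ
    im : ℚ
open ℚ√5 public

infixl 6 _⊕_ _⊖_
infixl 7 _⊗_

_⊕_ : ℚ√5 → ℚ√5 → ℚ√5
(a +√5· b) ⊕ (c +√5· d) = (a ℚ.+ c) +√5· (b ℚ.+ d)

⊝_ : ℚ√5 → ℚ√5
⊝ (a +√5· b) = (ℚ.- a) +√5· (ℚ.- b)

_⊖_ : ℚ√5 → ℚ√5 → ℚ√5
x ⊖ y = x ⊕ (⊝ y)

_⊗_ : ℚ√5 → ℚ√5 → ℚ√5
(a +√5· b) ⊗ (c +√5· d) =
  ((a ℚ.* c) ℚ.+ (ℤ.+ 5 ℚ./ 1) ℚ.* (b ℚ.* d)) +√5· ((a ℚ.* d) ℚ.+ (b ℚ.* c))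

ι : ℚ → ℚ√5
ι q = q +√5· 0ℚ

𝟘 𝟙 √5 : ℚ√5
𝟘 = ι 0ℚ
𝟙 = ι 1ℚ
√5 = 0ℚ +√5· 1ℚ

-- multiplicative inverse (a - b√5)/(a² - 5b²); the norm a² - 5b² vanishes
-- only at 0 (√5 irrational), where we set inv 0 = 0 (never used below,
-- since L_j ≠ 0 for every integer j).
inv : ℚ√5 → ℚ√5
inv (a +√5· b) with (a ℚ.* a ℚ.- (ℤ.+ 5 ℚ./ 1) ℚ.* (b ℚ.* b)) ≟ 0ℚ
... | yes _ = 𝟘
... | no ¬p = let instance _ = ℚB.≢-nonZero ¬p
                  m = 1/ (a ℚ.* a ℚ.- (ℤ.+ 5 ℚ./ 1) ℚ.* (b ℚ.* b))
              in (a ℚ.* m) +√5· (ℚ.- (b ℚ.* m))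

infixl 7 _⊘_
_⊘_ : ℚ√5 → ℚ√5 → ℚ√5
x ⊘ y = x ⊗ inv y

_^ℕ_ : ℚ√5 → ℕ → ℚ√5
x ^ℕ zero = 𝟙
x ^ℕ suc n = x ⊗ (x ^ℕ n)

_^ℤ_ : ℚ√5 → ℤ → ℚ√5
x ^ℤ (+ n) = x ^ℕ n
x ^ℤ -[1+ n ] = inv x ^ℕ suc n

ℕ→ : ℕ → ℚ√5
ℕ→ n = ι (ℤ.+ n ℚ./ 1)

α β : ℚ√5
α = (1ℚ ℚ.÷ (ℤ.+ 2 ℚ./ 1)) +√5· (1ℚ ℚ.÷ (ℤ.+ 2 ℚ./ 1))
β = (1ℚ ℚ.÷ (ℤ.+ 2 ℚ./ 1)) +√5· (ℚ.- (1ℚ ℚ.÷ (ℤ.+ 2 ℚ./ 1)))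

F : ℤ → ℚ√5
F s = ((α ^ℤ s) ⊖ (β ^ℤ s)) ⊘ √5

L : ℤ → ℚ√5
L s = (α ^ℤ s) ⊕ (β ^ℤ s)

-- Sums  Σ_{k=a}^{b} f k  (empty if b < a)

Σ[_⋯_] : ℕ → ℕ → (ℕ → ℚ√5) → ℚ√5
Σ[ a ⋯ b ] f = go a (suc b ℕ.∸ a)
  where
  go : ℕ → ℕ → ℚ√5
  go i zero = 𝟘
  go i (suc r) = f i ⊕ go (suc i) r

-- Bernoulli numbers B_n = B_n(0) for  z e^{xz}/(e^z - 1)  (so B_1 = -1/2),
-- computed by the recurrence  Σ_{k=0}^{n} C(n+1,k) B_k = 0  (n ≥ 1), B_0 = 1,
-- which is the coefficient identity of  (e^z - 1) · Σ B_n z^n/n! = z.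

bernoulliList : ℕ → List ℚ
bernoulliList zero = 1ℚ ∷ []
bernoulliList (suc n) = bs ++ [ ℚ.- (s ℚ.* (ℤ.+ 1 ℚ./ suc (suc n))) ]
  where
  bs = bernoulliList n
  s = foldr ℚ._+_ 0ℚ (zipWith (λ k b → (ℤ.+ ((n ℕ.+ 2) C k) ℚ./ 1) ℚ.* b) (upTo (suc n)) bs)

nth : List ℚ → ℕ → ℚ
nth [] _ = 0ℚ
nth (x ∷ xs) zero = x
nth (x ∷ xs) (suc i) = nth xs i

bernoulli : ℕ → ℚ
bernoulli n = nth (bernoulliList n) n

bernoulliPoly : ℕ → ℚ√5 → ℚ√5
bernoulliPoly n x = Σ[ 0 ⋯ n ] (λ k → ℕ→ (n C k) ⊗ ι (bernoulli k) ⊗ (x ^ℕ (n ℕ.∸ k)))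

{-# OPTIONS --safe #-}
module Submission where

-- Put x = α^j/L_j. Since α^j + β^j = L_j, we have β^j/L_j = 1 - x, so every summand is of the form
-- c·x^k + d·(1-x)^k; for instance F_{jk-1}/L_j^k = (-β/√5)·x^k + (α/√5)·(1-x)^k because α⁻¹ = -β and
-- β⁻¹ = -α. Each sum is therefore c·B_n(x) + d·B_n(1-x), and the reflection formula
-- B_n(1-x) = (-1)^n B_n(x) turns it into (c + (-1)^n d)·B_n(x), with coefficient 1, 0, √5 or 0.
-- Reflection is proved with binomial convolution, i.e. products of exponential generating functions:
-- B_n(y) is the convolution of the Bernoulli numbers with the powers of y, so it reduces to
-- B_n(1) = (-1)^n B_n, a consequence of the defining relation B(z)e^z = B(z) + z.

open import Defs
open import Data.Nat using (ℕ; _∸_)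
open import Data.Nat.Combinatorics using (_C_)
open import Data.Integer using (ℤ; +_; _*_; _-_)
open import Data.Product using (_×_)
open import Relation.Binary.PropositionalEquality using (_≡_)

open import Level using (0ℓ)
open import Function using (_∘_)
open import Data.Nat as ℕ using (zero; suc; _<_; s≤s; z≤n)
import Data.Nat.Properties as ℕₚ
open import Data.Nat.Combinatorics using (nCk+nC[k+1]≡[n+1]C[k+1]; nCn≡1; nC1≡n; nCk≡nC[n∸k])
open import Data.Nat.Combinatorics.Specification using (k>n⇒nCk≡0)
open import Data.Integer as ℤ using (-[1+_])
import Data.Integer.Properties as ℤₚ
open import Data.Rational as ℚ using (ℚ; 0ℚ; 1ℚ; mkℚ)
import Data.Rational.Properties as ℚₚ
import Data.Nat.Coprimality as Coprimality
open import Data.List using (_∷ʳ_; zipWith; upTo; foldr; applyUpTo)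
open import Data.List.Properties using (applyUpTo-∷ʳ)
open import Data.Product using (∃; _,_; proj₁; proj₂)
open import Data.Sum using (inj₁; inj₂)
open import Data.Empty using (⊥-elim)
open import Relation.Nullary using (yes; no)
open import Relation.Nullary.Decidable using (map′; _×-dec_; dec⇒maybe)
open import Relation.Binary.Definitions using (DecidableEquality)
open import Relation.Binary.PropositionalEquality
  using (refl; sym; trans; cong; cong₂; _≗_; isEquivalence; module ≡-Reasoning)
open import Algebra.Structures {A = ℚ√5} _≡_ using (IsCommutativeRing)
open import Algebra.Bundles using (CommutativeRing)
open import Tactic.RingSolver using (solve-∀)
open import Tactic.RingSolver.Core.AlmostCommutativeRing
  using (AlmostCommutativeRing; fromCommutativeRing)

open ≡-Reasoning

ℚ-ring : AlmostCommutativeRing 0ℓ 0ℓ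
ℚ-ring = fromCommutativeRing ℚₚ.+-*-commutativeRing (λ x → dec⇒maybe (0ℚ ℚₚ.≟ x))

-- The constant 5 of the multiplication _⊗_, passed to the ring solver as a variable.
five : ℚ
five = + 5 ℚ./ 1

⊕-assoc : ∀ x y z → (x ⊕ y) ⊕ z ≡ x ⊕ (y ⊕ z)
⊕-assoc (a +√5· b) (c +√5· d) (e +√5· f) = cong₂ _+√5·_ (ℚₚ.+-assoc a c e) (ℚₚ.+-assoc b d f)

⊕-comm : ∀ x y → x ⊕ y ≡ y ⊕ x
⊕-comm (a +√5· b) (c +√5· d) = cong₂ _+√5·_ (ℚₚ.+-comm a c) (ℚₚ.+-comm b d)

⊕-identityˡ : ∀ x → 𝟘 ⊕ x ≡ x
⊕-identityˡ (a +√5· b) = cong₂ _+√5·_ (ℚₚ.+-identityˡ a) (ℚₚ.+-identityˡ b)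

⊕-identityʳ : ∀ x → x ⊕ 𝟘 ≡ x
⊕-identityʳ (a +√5· b) = cong₂ _+√5·_ (ℚₚ.+-identityʳ a) (ℚₚ.+-identityʳ b)

⊝-inverseˡ : ∀ x → (⊝ x) ⊕ x ≡ 𝟘
⊝-inverseˡ (a +√5· b) = cong₂ _+√5·_ (ℚₚ.+-inverseˡ a) (ℚₚ.+-inverseˡ b)

⊝-inverseʳ : ∀ x → x ⊕ (⊝ x) ≡ 𝟘
⊝-inverseʳ (a +√5· b) = cong₂ _+√5·_ (ℚₚ.+-inverseʳ a) (ℚₚ.+-inverseʳ b)

⊗-comm : ∀ x y → x ⊗ y ≡ y ⊗ x
⊗-comm (a +√5· b) (c +√5· d) = cong₂ _+√5·_ (re-comm a b c d five) (im-comm a b c d)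
  where
  re-comm : ∀ a b c d k → a ℚ.* c ℚ.+ k ℚ.* (b ℚ.* d) ≡ c ℚ.* a ℚ.+ k ℚ.* (d ℚ.* b)
  re-comm = solve-∀ ℚ-ring
  im-comm : ∀ a b c d → a ℚ.* d ℚ.+ b ℚ.* c ≡ c ℚ.* b ℚ.+ d ℚ.* a
  im-comm = solve-∀ ℚ-ring

⊗-assoc : ∀ x y z → (x ⊗ y) ⊗ z ≡ x ⊗ (y ⊗ z)
⊗-assoc (a +√5· b) (c +√5· d) (e +√5· f) =
  cong₂ _+√5·_ (re-assoc a b c d e f five) (im-assoc a b c d e f five)
  where
  re-assoc : ∀ a b c d e f k →
    (a ℚ.* c ℚ.+ k ℚ.* (b ℚ.* d)) ℚ.* e ℚ.+ k ℚ.* ((a ℚ.* d ℚ.+ b ℚ.* c) ℚ.* f)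
      ≡ a ℚ.* (c ℚ.* e ℚ.+ k ℚ.* (d ℚ.* f)) ℚ.+ k ℚ.* (b ℚ.* (c ℚ.* f ℚ.+ d ℚ.* e))
  re-assoc = solve-∀ ℚ-ring
  im-assoc : ∀ a b c d e f k →
    (a ℚ.* c ℚ.+ k ℚ.* (b ℚ.* d)) ℚ.* f ℚ.+ (a ℚ.* d ℚ.+ b ℚ.* c) ℚ.* e
      ≡ a ℚ.* (c ℚ.* f ℚ.+ d ℚ.* e) ℚ.+ b ℚ.* (c ℚ.* e ℚ.+ k ℚ.* (d ℚ.* f))
  im-assoc = solve-∀ ℚ-ring

⊗-identityˡ : ∀ x → 𝟙 ⊗ x ≡ x
⊗-identityˡ (a +√5· b) = cong₂ _+√5·_ (re-identity a b five) (im-identity a b)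
  where
  re-identity : ∀ a b k → 1ℚ ℚ.* a ℚ.+ k ℚ.* (0ℚ ℚ.* b) ≡ a
  re-identity = solve-∀ ℚ-ring
  im-identity : ∀ a b → 1ℚ ℚ.* b ℚ.+ 0ℚ ℚ.* a ≡ b
  im-identity = solve-∀ ℚ-ring

⊗-identityʳ : ∀ x → x ⊗ 𝟙 ≡ x
⊗-identityʳ x = trans (⊗-comm x 𝟙) (⊗-identityˡ x)

⊗-distribˡ-⊕ : ∀ x y z → x ⊗ (y ⊕ z) ≡ (x ⊗ y) ⊕ (x ⊗ z)
⊗-distribˡ-⊕ (a +√5· b) (c +√5· d) (e +√5· f) =
  cong₂ _+√5·_ (re-distrib a b c d e f five) (im-distrib a b c d e f)
  where
  re-distrib : ∀ a b c d e f k →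
    a ℚ.* (c ℚ.+ e) ℚ.+ k ℚ.* (b ℚ.* (d ℚ.+ f))
      ≡ (a ℚ.* c ℚ.+ k ℚ.* (b ℚ.* d)) ℚ.+ (a ℚ.* e ℚ.+ k ℚ.* (b ℚ.* f))
  re-distrib = solve-∀ ℚ-ring
  im-distrib : ∀ a b c d e f →
    a ℚ.* (d ℚ.+ f) ℚ.+ b ℚ.* (c ℚ.+ e) ≡ (a ℚ.* d ℚ.+ b ℚ.* c) ℚ.+ (a ℚ.* f ℚ.+ b ℚ.* e)
  im-distrib = solve-∀ ℚ-ring

⊗-distribʳ-⊕ : ∀ x y z → (y ⊕ z) ⊗ x ≡ (y ⊗ x) ⊕ (z ⊗ x)
⊗-distribʳ-⊕ x y z =
  trans (⊗-comm (y ⊕ z) x) (trans (⊗-distribˡ-⊕ x y z) (cong₂ _⊕_ (⊗-comm x y) (⊗-comm x z)))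

ℚ√5-isCommutativeRing : IsCommutativeRing _⊕_ _⊗_ ⊝_ 𝟘 𝟙
ℚ√5-isCommutativeRing = record
  { isRing = record
    { +-isAbelianGroup = record
      { isGroup = record
        { isMonoid = record
          { isSemigroup = record
            { isMagma = record { isEquivalence = isEquivalence ; ∙-cong = cong₂ _⊕_ }
            ; assoc = ⊕-assoc
            }
          ; identity = ⊕-identityˡ , ⊕-identityʳ
          }
        ; inverse = ⊝-inverseˡ , ⊝-inverseʳ
        ; ⁻¹-cong = cong ⊝_
        }
      ; comm = ⊕-comm
      }
    ; *-cong = cong₂ _⊗_
    ; *-assoc = ⊗-assoc
    ; *-identity = ⊗-identityˡ , ⊗-identityʳ
    ; distrib = ⊗-distribˡ-⊕ , ⊗-distribʳ-⊕
    }
  ; *-comm = ⊗-comm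
  }

ℚ√5-commutativeRing : CommutativeRing 0ℓ 0ℓ
ℚ√5-commutativeRing = record { isCommutativeRing = ℚ√5-isCommutativeRing }

_≟√5_ : DecidableEquality ℚ√5
(a +√5· b) ≟√5 (c +√5· d) =
  map′ (λ (p , q) → cong₂ _+√5·_ p q) (λ { refl → refl , refl }) ((a ℚₚ.≟ c) ×-dec (b ℚₚ.≟ d))

ℚ√5-ring : AlmostCommutativeRing 0ℓ 0ℓ
ℚ√5-ring = fromCommutativeRing ℚ√5-commutativeRing (λ x → dec⇒maybe (𝟘 ≟√5 x))

⊗-zeroʳ : ∀ x → x ⊗ 𝟘 ≡ 𝟘
⊗-zeroʳ = solve-∀ ℚ√5-ring

⊗-zeroˡ : ∀ x → 𝟘 ⊗ x ≡ 𝟘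
⊗-zeroˡ = solve-∀ ℚ√5-ring

+/1≡mkℚ : ∀ m → (+ m ℚ./ 1) ≡ mkℚ (+ m) 0 (Coprimality.sym (Coprimality.1-coprimeTo m))
+/1≡mkℚ m = ℚₚ.normalize-coprime (Coprimality.sym (Coprimality.1-coprimeTo m))

+/1-+ : ∀ m n → (+ (m ℕ.+ n) ℚ./ 1) ≡ (+ m ℚ./ 1) ℚ.+ (+ n ℚ./ 1)
+/1-+ m n rewrite +/1≡mkℚ m | +/1≡mkℚ n =
  sym (ℚₚ./-cong (cong₂ ℤ._+_ (ℤₚ.*-identityʳ (+ m)) (ℤₚ.*-identityʳ (+ n))) refl)

+/1-inverse : ∀ k → (+ suc k ℚ./ 1) ℚ.* (+ 1 ℚ./ suc k) ≡ 1ℚ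
+/1-inverse k rewrite +/1≡mkℚ (suc k) | ℚₚ.normalize-coprime {1} {k} (Coprimality.1-coprimeTo (suc k)) =
  ℚₚ.*-inverseʳ (mkℚ (+ suc k) 0 (Coprimality.sym (Coprimality.1-coprimeTo (suc k))))

ι-* : ∀ p q → ι (p ℚ.* q) ≡ ι p ⊗ ι q
ι-* p q = cong₂ _+√5·_ (re-* p q five) (im-* p q)
  where
  re-* : ∀ p q k → p ℚ.* q ≡ p ℚ.* q ℚ.+ k ℚ.* (0ℚ ℚ.* 0ℚ)
  re-* = solve-∀ ℚ-ring
  im-* : ∀ p q → 0ℚ ≡ p ℚ.* 0ℚ ℚ.+ 0ℚ ℚ.* q
  im-* = solve-∀ ℚ-ring

ℕ→-+ : ∀ m n → ℕ→ (m ℕ.+ n) ≡ ℕ→ m ⊕ ℕ→ n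
ℕ→-+ m n = cong ι (+/1-+ m n)

ℕ→-suc-cancel : ∀ n c → ℕ→ (suc n) ⊗ c ≡ 𝟘 → c ≡ 𝟘
ℕ→-suc-cancel n c nc≡0 = begin
  c                                  ≡⟨ sym (⊗-identityˡ c) ⟩
  𝟙 ⊗ c                              ≡⟨ cong (_⊗ c) (sym inverse) ⟩
  (ℕ→ (suc n) ⊗ ι (+ 1 ℚ./ suc n)) ⊗ c ≡⟨ swap (ℕ→ (suc n)) (ι (+ 1 ℚ./ suc n)) c ⟩
  ι (+ 1 ℚ./ suc n) ⊗ (ℕ→ (suc n) ⊗ c) ≡⟨ cong (ι (+ 1 ℚ./ suc n) ⊗_) nc≡0 ⟩
  ι (+ 1 ℚ./ suc n) ⊗ 𝟘              ≡⟨ ⊗-zeroʳ (ι (+ 1 ℚ./ suc n)) ⟩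
  𝟘                                  ∎
  where
  inverse : ℕ→ (suc n) ⊗ ι (+ 1 ℚ./ suc n) ≡ 𝟙
  inverse = trans (sym (ι-* (+ suc n ℚ./ 1) (+ 1 ℚ./ suc n))) (cong ι (+/1-inverse n))
  swap : ∀ x y z → (x ⊗ y) ⊗ z ≡ y ⊗ (x ⊗ z)
  swap = solve-∀ ℚ√5-ring

^ℕ-distribˡ-+ : ∀ x a c → x ^ℕ (a ℕ.+ c) ≡ x ^ℕ a ⊗ x ^ℕ c
^ℕ-distribˡ-+ x zero c = sym (⊗-identityˡ (x ^ℕ c))
^ℕ-distribˡ-+ x (suc a) c =
  trans (cong (x ⊗_) (^ℕ-distribˡ-+ x a c)) (sym (⊗-assoc x (x ^ℕ a) (x ^ℕ c)))

^ℕ-distribʳ-⊗ : ∀ u v k → (u ⊗ v) ^ℕ k ≡ u ^ℕ k ⊗ v ^ℕ k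
^ℕ-distribʳ-⊗ u v zero = refl
^ℕ-distribʳ-⊗ u v (suc k) =
  trans (cong ((u ⊗ v) ⊗_) (^ℕ-distribʳ-⊗ u v k)) (interchange u v (u ^ℕ k) (v ^ℕ k))
  where
  interchange : ∀ a b c d → (a ⊗ b) ⊗ (c ⊗ d) ≡ (a ⊗ c) ⊗ (b ⊗ d)
  interchange = solve-∀ ℚ√5-ring

𝟙^ℕ : ∀ k → 𝟙 ^ℕ k ≡ 𝟙
𝟙^ℕ zero = refl
𝟙^ℕ (suc k) = trans (⊗-identityˡ (𝟙 ^ℕ k)) (𝟙^ℕ k)

sign : ℕ → ℚ√5
sign k = (⊝ 𝟙) ^ℕ k

sign-square : ∀ k → sign k ⊗ sign k ≡ 𝟙
sign-square zero = refl
sign-square (suc k) = trans (square-neg (sign k)) (sign-square k)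
  where
  square-neg : ∀ s → (⊝ 𝟙 ⊗ s) ⊗ (⊝ 𝟙 ⊗ s) ≡ s ⊗ s
  square-neg = solve-∀ ℚ√5-ring

sign-even : ∀ {n} → Even n → sign n ≡ 𝟙
sign-even (m , refl) = begin
  sign (m ℕ.+ (m ℕ.+ 0))           ≡⟨ ^ℕ-distribˡ-+ (⊝ 𝟙) m (m ℕ.+ 0) ⟩
  sign m ⊗ sign (m ℕ.+ 0)          ≡⟨ cong (λ e → sign m ⊗ sign e) (ℕₚ.+-identityʳ m) ⟩
  sign m ⊗ sign m                  ≡⟨ sign-square m ⟩
  𝟙                                ∎

sign-odd : ∀ {n} → Odd n → sign n ≡ ⊝ 𝟙
sign-odd (m , refl) = trans (cong (⊝ 𝟙 ⊗_) (sign-even (m , refl))) (⊗-identityʳ (⊝ 𝟙))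

^ℕ-neg : ∀ x k → (⊝ x) ^ℕ k ≡ sign k ⊗ x ^ℕ k
^ℕ-neg x zero = refl
^ℕ-neg x (suc k) = trans (cong (⊝ x ⊗_) (^ℕ-neg x k)) (regroup x (sign k) (x ^ℕ k))
  where
  regroup : ∀ x s p → ⊝ x ⊗ (s ⊗ p) ≡ (⊝ 𝟙 ⊗ s) ⊗ (x ⊗ p)
  regroup = solve-∀ ℚ√5-ring

∑ : ℕ → (ℕ → ℚ√5) → ℚ√5
∑ zero f = 𝟘
∑ (suc n) f = f 0 ⊕ ∑ n (f ∘ suc)

∑-cong-< : ∀ n {f g} → (∀ k → k < n → f k ≡ g k) → ∑ n f ≡ ∑ n g
∑-cong-< zero eq = refl
∑-cong-< (suc n) eq = cong₂ _⊕_ (eq 0 (s≤s z≤n)) (∑-cong-< n (λ k k<n → eq (suc k) (s≤s k<n)))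

∑-cong : ∀ n {f g} → f ≗ g → ∑ n f ≡ ∑ n g
∑-cong n eq = ∑-cong-< n (λ k _ → eq k)

∑-distrib-⊕ : ∀ n f g → ∑ n (λ k → f k ⊕ g k) ≡ ∑ n f ⊕ ∑ n g
∑-distrib-⊕ zero f g = sym (⊕-identityˡ 𝟘)
∑-distrib-⊕ (suc n) f g =
  trans (cong ((f 0 ⊕ g 0) ⊕_) (∑-distrib-⊕ n (f ∘ suc) (g ∘ suc)))
        (medial (f 0) (g 0) (∑ n (f ∘ suc)) (∑ n (g ∘ suc)))
  where
  medial : ∀ a b c d → (a ⊕ b) ⊕ (c ⊕ d) ≡ (a ⊕ c) ⊕ (b ⊕ d)
  medial = solve-∀ ℚ√5-ring

∑-distribˡ-⊗ : ∀ n c f → ∑ n (λ k → c ⊗ f k) ≡ c ⊗ ∑ n f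
∑-distribˡ-⊗ zero c f = sym (⊗-zeroʳ c)
∑-distribˡ-⊗ (suc n) c f =
  trans (cong (c ⊗ f 0 ⊕_) (∑-distribˡ-⊗ n c (f ∘ suc))) (sym (⊗-distribˡ-⊕ c (f 0) (∑ n (f ∘ suc))))

∑-zero : ∀ n f → (∀ k → k < n → f k ≡ 𝟘) → ∑ n f ≡ 𝟘
∑-zero zero f vanish = refl
∑-zero (suc n) f vanish =
  trans (cong₂ _⊕_ (vanish 0 (s≤s z≤n)) (∑-zero n (f ∘ suc) (λ k k<n → vanish (suc k) (s≤s k<n))))
        (⊕-identityˡ 𝟘)

∑-last : ∀ n f → ∑ (suc n) f ≡ ∑ n f ⊕ f n
∑-last zero f = trans (⊕-identityʳ (f 0)) (sym (⊕-identityˡ (f 0)))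
∑-last (suc n) f =
  trans (cong (f 0 ⊕_) (∑-last n (f ∘ suc))) (sym (⊕-assoc (f 0) (∑ n (f ∘ suc)) (f (suc n))))

∑-drop-last : ∀ n f → f n ≡ 𝟘 → ∑ (suc n) f ≡ ∑ n f
∑-drop-last n f fn≡0 = trans (∑-last n f) (trans (cong (∑ n f ⊕_) fn≡0) (⊕-identityʳ (∑ n f)))

suc-∸≡suc⇒≤ : ∀ a b {r} → suc b ∸ a ≡ suc r → a ℕ.≤ b
suc-∸≡suc⇒≤ a b length≡1+r =
  ℕ.s≤s⁻¹ (ℕₚ.m∸n≢0⇒n<m (λ length≡0 → ℕₚ.0≢1+n (trans (sym length≡0) length≡1+r)))

Σ[⋯]≡∑ : ∀ r a b f → suc b ∸ a ≡ r → Σ[ a ⋯ b ] f ≡ ∑ r (λ k → f (a ℕ.+ k))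
Σ[⋯]≡∑ zero a b f length≡0 rewrite length≡0 = refl
Σ[⋯]≡∑ (suc r) a b f length≡1+r
  rewrite ℕₚ.+-∸-assoc 1 (suc-∸≡suc⇒≤ a b length≡1+r) | ℕₚ.+-identityʳ a =
  cong (f a ⊕_) (trans (Σ[⋯]≡∑ r (suc a) b f length≡r) (∑-cong r (λ k → cong f (sym (ℕₚ.+-suc a k)))))
  where
  length≡r : b ∸ a ≡ r
  length≡r = ℕₚ.suc-injective (trans (sym (ℕₚ.+-∸-assoc 1 (suc-∸≡suc⇒≤ a b length≡1+r))) length≡1+r)

Σ[0⋯]≡∑ : ∀ n f → Σ[ 0 ⋯ n ] f ≡ ∑ (suc n) f
Σ[0⋯]≡∑ n f = Σ[⋯]≡∑ (suc n) 0 n f refl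

Σ[1⋯]≡Σ[0⋯] : ∀ n f → f 0 ≡ 𝟘 → Σ[ 1 ⋯ n ] f ≡ Σ[ 0 ⋯ n ] f
Σ[1⋯]≡Σ[0⋯] n f f0≡0 = begin
  Σ[ 1 ⋯ n ] f       ≡⟨ Σ[⋯]≡∑ n 1 n f refl ⟩
  ∑ n (f ∘ suc)      ≡⟨ sym (⊕-identityˡ (∑ n (f ∘ suc))) ⟩
  𝟘 ⊕ ∑ n (f ∘ suc)  ≡⟨ cong (_⊕ ∑ n (f ∘ suc)) (sym f0≡0) ⟩
  ∑ (suc n) f        ≡⟨ sym (Σ[0⋯]≡∑ n f) ⟩
  Σ[ 0 ⋯ n ] f       ∎

-- Binomial convolution: the product of exponential generating functions

infixl 7 _⋆_

convolutionTerm : (ℕ → ℚ√5) → (ℕ → ℚ√5) → ℕ → ℕ → ℚ√5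
convolutionTerm a b n k = ℕ→ (n C k) ⊗ a k ⊗ b (n ∸ k)

_⋆_ : (ℕ → ℚ√5) → (ℕ → ℚ√5) → ℕ → ℚ√5
(a ⋆ b) n = ∑ (suc n) (convolutionTerm a b n)

shift : (ℕ → ℚ√5) → ℕ → ℚ√5
shift a = a ∘ suc

powers : ℚ√5 → ℕ → ℚ√5
powers x k = x ^ℕ k

twist : (ℕ → ℚ√5) → ℕ → ℚ√5
twist a k = sign k ⊗ a k

nC0≡1 : ∀ n → n C 0 ≡ 1
nC0≡1 n = trans (nCk≡nC[n∸k] {0} {n} z≤n) (nCn≡1 n)

[1+n]Cn≡1+n : ∀ n → suc n C n ≡ suc n
[1+n]Cn≡1+n n = trans (nCk≡nC[n∸k] (ℕₚ.n≤1+n n)) (trans (cong (suc n C_) (ℕₚ.m+n∸n≡m 1 n)) (nC1≡n (suc n)))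

⋆-leibniz : ∀ a b n → (a ⋆ b) (suc n) ≡ (shift a ⋆ b) n ⊕ (a ⋆ shift b) n
⋆-leibniz a b n = begin
  head₊ ⊕ ∑ (suc n) (λ k → ℕ→ (suc n C suc k) ⊗ a (suc k) ⊗ b (n ∸ k))
    ≡⟨ cong (head₊ ⊕_) (trans (∑-cong (suc n) pascal)
                              (∑-distrib-⊕ (suc n) (convolutionTerm (shift a) b n) upper)) ⟩
  head₊ ⊕ ((shift a ⋆ b) n ⊕ ∑ (suc n) upper)
    ≡⟨ cong (λ s → head₊ ⊕ ((shift a ⋆ b) n ⊕ s)) (∑-drop-last n upper upper-last) ⟩
  head₊ ⊕ ((shift a ⋆ b) n ⊕ ∑ n upper)
    ≡⟨ left-comm head₊ ((shift a ⋆ b) n) (∑ n upper) ⟩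
  (shift a ⋆ b) n ⊕ (head₊ ⊕ ∑ n upper)
    ≡⟨ cong₂ (λ h s → (shift a ⋆ b) n ⊕ (h ⊕ s)) head-eq (∑-cong-< n upper-eq) ⟩
  (shift a ⋆ b) n ⊕ (a ⋆ shift b) n ∎
  where
  head₊ = ℕ→ (suc n C 0) ⊗ a 0 ⊗ b (suc n)
  upper : ℕ → ℚ√5
  upper k = ℕ→ (n C suc k) ⊗ a (suc k) ⊗ b (n ∸ k)
  distrib : ∀ x y z w → (x ⊕ y) ⊗ z ⊗ w ≡ x ⊗ z ⊗ w ⊕ y ⊗ z ⊗ w
  distrib = solve-∀ ℚ√5-ring
  pascal : ∀ k → ℕ→ (suc n C suc k) ⊗ a (suc k) ⊗ b (n ∸ k)
               ≡ ℕ→ (n C k) ⊗ a (suc k) ⊗ b (n ∸ k) ⊕ upper k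
  pascal k = begin
    ℕ→ (suc n C suc k) ⊗ a (suc k) ⊗ b (n ∸ k)
      ≡⟨ cong (λ c → ℕ→ c ⊗ a (suc k) ⊗ b (n ∸ k)) (sym (nCk+nC[k+1]≡[n+1]C[k+1] n k)) ⟩
    ℕ→ (n C k ℕ.+ n C suc k) ⊗ a (suc k) ⊗ b (n ∸ k)
      ≡⟨ cong (λ c → c ⊗ a (suc k) ⊗ b (n ∸ k)) (ℕ→-+ (n C k) (n C suc k)) ⟩
    (ℕ→ (n C k) ⊕ ℕ→ (n C suc k)) ⊗ a (suc k) ⊗ b (n ∸ k)
      ≡⟨ distrib (ℕ→ (n C k)) (ℕ→ (n C suc k)) (a (suc k)) (b (n ∸ k)) ⟩
    ℕ→ (n C k) ⊗ a (suc k) ⊗ b (n ∸ k) ⊕ upper k ∎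
  upper-last : upper n ≡ 𝟘
  upper-last = trans (cong (λ c → ℕ→ c ⊗ a (suc n) ⊗ b (n ∸ n)) (k>n⇒nCk≡0 (ℕₚ.n<1+n n)))
                     (trans (cong (_⊗ b (n ∸ n)) (⊗-zeroˡ (a (suc n)))) (⊗-zeroˡ (b (n ∸ n))))
  left-comm : ∀ x y z → x ⊕ (y ⊕ z) ≡ y ⊕ (x ⊕ z)
  left-comm = solve-∀ ℚ√5-ring
  head-eq : head₊ ≡ ℕ→ (n C 0) ⊗ a 0 ⊗ b (suc n)
  head-eq = cong (λ c → ℕ→ c ⊗ a 0 ⊗ b (suc n)) (trans (nC0≡1 (suc n)) (sym (nC0≡1 n)))
  upper-eq : ∀ k → k < n → upper k ≡ ℕ→ (n C suc k) ⊗ a (suc k) ⊗ shift b (n ∸ suc k)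
  upper-eq k k<n = cong (λ i → ℕ→ (n C suc k) ⊗ a (suc k) ⊗ b i) (ℕₚ.+-∸-assoc 1 k<n)

⋆-cong : ∀ {a a′ b b′} → a ≗ a′ → b ≗ b′ → a ⋆ b ≗ a′ ⋆ b′
⋆-cong a≗a′ b≗b′ n =
  ∑-cong (suc n) (λ k → cong₂ (λ u v → ℕ→ (n C k) ⊗ u ⊗ v) (a≗a′ k) (b≗b′ (n ∸ k)))

⋆-congˡ : ∀ {a a′} b → a ≗ a′ → a ⋆ b ≗ a′ ⋆ b
⋆-congˡ b a≗a′ = ⋆-cong {b = b} a≗a′ (λ _ → refl)

⋆-congʳ : ∀ a {b b′} → b ≗ b′ → a ⋆ b ≗ a ⋆ b′
⋆-congʳ a b≗b′ = ⋆-cong {a = a} (λ _ → refl) b≗b′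

⋆-comm : ∀ a b → a ⋆ b ≗ b ⋆ a
⋆-comm a b zero = cong (_⊕ 𝟘) (swap (a 0) (b 0))
  where
  swap : ∀ x y → 𝟙 ⊗ x ⊗ y ≡ 𝟙 ⊗ y ⊗ x
  swap = solve-∀ ℚ√5-ring
⋆-comm a b (suc n) = begin
  (a ⋆ b) (suc n)                          ≡⟨ ⋆-leibniz a b n ⟩
  (shift a ⋆ b) n ⊕ (a ⋆ shift b) n        ≡⟨ cong₂ _⊕_ (⋆-comm (shift a) b n) (⋆-comm a (shift b) n) ⟩
  (b ⋆ shift a) n ⊕ (shift b ⋆ a) n        ≡⟨ ⊕-comm ((b ⋆ shift a) n) ((shift b ⋆ a) n) ⟩
  (shift b ⋆ a) n ⊕ (b ⋆ shift a) n        ≡⟨ sym (⋆-leibniz b a n) ⟩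
  (b ⋆ a) (suc n)                          ∎

⋆-distribʳ-⊕ : ∀ a a′ b → (λ k → a k ⊕ a′ k) ⋆ b ≗ λ n → (a ⋆ b) n ⊕ (a′ ⋆ b) n
⋆-distribʳ-⊕ a a′ b n =
  trans (∑-cong (suc n) (λ k → distrib (ℕ→ (n C k)) (a k) (a′ k) (b (n ∸ k))))
        (∑-distrib-⊕ (suc n) (convolutionTerm a b n) (convolutionTerm a′ b n))
  where
  distrib : ∀ c x y z → c ⊗ (x ⊕ y) ⊗ z ≡ c ⊗ x ⊗ z ⊕ c ⊗ y ⊗ z
  distrib = solve-∀ ℚ√5-ring

⋆-distribˡ-⊕ : ∀ a b b′ → a ⋆ (λ k → b k ⊕ b′ k) ≗ λ n → (a ⋆ b) n ⊕ (a ⋆ b′) n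
⋆-distribˡ-⊕ a b b′ n =
  trans (∑-cong (suc n) (λ k → distrib (ℕ→ (n C k)) (a k) (b (n ∸ k)) (b′ (n ∸ k))))
        (∑-distrib-⊕ (suc n) (convolutionTerm a b n) (convolutionTerm a b′ n))
  where
  distrib : ∀ c x y z → c ⊗ x ⊗ (y ⊕ z) ≡ c ⊗ x ⊗ y ⊕ c ⊗ x ⊗ z
  distrib = solve-∀ ℚ√5-ring

⋆-scaleˡ : ∀ c a b → (λ k → c ⊗ a k) ⋆ b ≗ λ n → c ⊗ (a ⋆ b) n
⋆-scaleˡ c a b n =
  trans (∑-cong (suc n) (λ k → pull c (ℕ→ (n C k)) (a k) (b (n ∸ k))))
        (∑-distribˡ-⊗ (suc n) c (convolutionTerm a b n))
  where
  pull : ∀ c d x z → d ⊗ (c ⊗ x) ⊗ z ≡ c ⊗ (d ⊗ x ⊗ z)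
  pull = solve-∀ ℚ√5-ring

⋆-scaleʳ : ∀ c a b → a ⋆ (λ k → c ⊗ b k) ≗ λ n → c ⊗ (a ⋆ b) n
⋆-scaleʳ c a b n =
  trans (∑-cong (suc n) (λ k → pull c (ℕ→ (n C k)) (a k) (b (n ∸ k))))
        (∑-distribˡ-⊗ (suc n) c (convolutionTerm a b n))
  where
  pull : ∀ c d x z → d ⊗ x ⊗ (c ⊗ z) ≡ c ⊗ (d ⊗ x ⊗ z)
  pull = solve-∀ ℚ√5-ring

⋆-assoc : ∀ a b c → (a ⋆ b) ⋆ c ≗ a ⋆ (b ⋆ c)
⋆-assoc a b c zero = shuffle (a 0) (b 0) (c 0)
  where
  shuffle : ∀ x y z → 𝟙 ⊗ (𝟙 ⊗ x ⊗ y ⊕ 𝟘) ⊗ z ⊕ 𝟘 ≡ 𝟙 ⊗ x ⊗ (𝟙 ⊗ y ⊗ z ⊕ 𝟘) ⊕ 𝟘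
  shuffle = solve-∀ ℚ√5-ring
⋆-assoc a b c (suc n) = begin
  ((a ⋆ b) ⋆ c) (suc n)
    ≡⟨ ⋆-leibniz (a ⋆ b) c n ⟩
  (shift (a ⋆ b) ⋆ c) n ⊕ ((a ⋆ b) ⋆ shift c) n
    ≡⟨ cong₂ _⊕_ (trans (⋆-congˡ c (⋆-leibniz a b) n) (⋆-distribʳ-⊕ (shift a ⋆ b) (a ⋆ shift b) c n))
                 (⋆-assoc a b (shift c) n) ⟩
  ((shift a ⋆ b) ⋆ c) n ⊕ ((a ⋆ shift b) ⋆ c) n ⊕ (a ⋆ (b ⋆ shift c)) n
    ≡⟨ cong (_⊕ (a ⋆ (b ⋆ shift c)) n) (cong₂ _⊕_ (⋆-assoc (shift a) b c n) (⋆-assoc a (shift b) c n)) ⟩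
  (shift a ⋆ (b ⋆ c)) n ⊕ (a ⋆ (shift b ⋆ c)) n ⊕ (a ⋆ (b ⋆ shift c)) n
    ≡⟨ ⊕-assoc ((shift a ⋆ (b ⋆ c)) n) ((a ⋆ (shift b ⋆ c)) n) ((a ⋆ (b ⋆ shift c)) n) ⟩
  (shift a ⋆ (b ⋆ c)) n ⊕ ((a ⋆ (shift b ⋆ c)) n ⊕ (a ⋆ (b ⋆ shift c)) n)
    ≡⟨ cong ((shift a ⋆ (b ⋆ c)) n ⊕_)
            (sym (trans (⋆-congʳ a (⋆-leibniz b c) n) (⋆-distribˡ-⊕ a (shift b ⋆ c) (b ⋆ shift c) n))) ⟩
  (shift a ⋆ (b ⋆ c)) n ⊕ (a ⋆ shift (b ⋆ c)) n
    ≡⟨ sym (⋆-leibniz a (b ⋆ c) n) ⟩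
  (a ⋆ (b ⋆ c)) (suc n) ∎

powers-⋆-powers : ∀ x y → powers x ⋆ powers y ≗ powers (x ⊕ y)
powers-⋆-powers x y zero = refl
powers-⋆-powers x y (suc n) = begin
  (powers x ⋆ powers y) (suc n)
    ≡⟨ ⋆-leibniz (powers x) (powers y) n ⟩
  (shift (powers x) ⋆ powers y) n ⊕ (powers x ⋆ shift (powers y)) n
    ≡⟨ cong₂ _⊕_ (⋆-scaleˡ x (powers x) (powers y) n) (⋆-scaleʳ y (powers x) (powers y) n) ⟩
  x ⊗ (powers x ⋆ powers y) n ⊕ y ⊗ (powers x ⋆ powers y) n
    ≡⟨ sym (⊗-distribʳ-⊕ ((powers x ⋆ powers y) n) x y) ⟩
  (x ⊕ y) ⊗ (powers x ⋆ powers y) n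
    ≡⟨ cong ((x ⊕ y) ⊗_) (powers-⋆-powers x y n) ⟩
  (x ⊕ y) ^ℕ suc n ∎

⋆-identityˡ : ∀ a → powers 𝟘 ⋆ a ≗ a
⋆-identityˡ a zero =
  trans (⊕-identityʳ (𝟙 ⊗ 𝟙 ⊗ a 0)) (trans (cong (_⊗ a 0) (⊗-identityˡ 𝟙)) (⊗-identityˡ (a 0)))
⋆-identityˡ a (suc n) = begin
  (powers 𝟘 ⋆ a) (suc n)
    ≡⟨ ⋆-leibniz (powers 𝟘) a n ⟩
  (shift (powers 𝟘) ⋆ a) n ⊕ (powers 𝟘 ⋆ shift a) n
    ≡⟨ cong₂ _⊕_ (⋆-scaleˡ 𝟘 (powers 𝟘) a n) (⋆-identityˡ (shift a) n) ⟩
  𝟘 ⊗ (powers 𝟘 ⋆ a) n ⊕ a (suc n)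
    ≡⟨ cong (_⊕ a (suc n)) (⊗-zeroˡ ((powers 𝟘 ⋆ a) n)) ⟩
  𝟘 ⊕ a (suc n)
    ≡⟨ ⊕-identityˡ (a (suc n)) ⟩
  a (suc n) ∎

twist-⋆-twist : ∀ a b → twist a ⋆ twist b ≗ twist (a ⋆ b)
twist-⋆-twist a b zero = shuffle (a 0) (b 0)
  where
  shuffle : ∀ x y → 𝟙 ⊗ (𝟙 ⊗ x) ⊗ (𝟙 ⊗ y) ⊕ 𝟘 ≡ 𝟙 ⊗ (𝟙 ⊗ x ⊗ y ⊕ 𝟘)
  shuffle = solve-∀ ℚ√5-ring
twist-⋆-twist a b (suc n) = begin
  (twist a ⋆ twist b) (suc n)
    ≡⟨ ⋆-leibniz (twist a) (twist b) n ⟩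
  (shift (twist a) ⋆ twist b) n ⊕ (twist a ⋆ shift (twist b)) n
    ≡⟨ cong₂ _⊕_ (trans (⋆-congˡ (twist b) (λ k → regroup (sign k) (a (suc k))) n)
                        (⋆-scaleˡ (⊝ 𝟙) (twist (shift a)) (twist b) n))
                 (trans (⋆-congʳ (twist a) (λ k → regroup (sign k) (b (suc k))) n)
                        (⋆-scaleʳ (⊝ 𝟙) (twist a) (twist (shift b)) n)) ⟩
  ⊝ 𝟙 ⊗ (twist (shift a) ⋆ twist b) n ⊕ ⊝ 𝟙 ⊗ (twist a ⋆ twist (shift b)) n
    ≡⟨ cong₂ (λ u v → ⊝ 𝟙 ⊗ u ⊕ ⊝ 𝟙 ⊗ v) (twist-⋆-twist (shift a) b n) (twist-⋆-twist a (shift b) n) ⟩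
  ⊝ 𝟙 ⊗ (sign n ⊗ (shift a ⋆ b) n) ⊕ ⊝ 𝟙 ⊗ (sign n ⊗ (a ⋆ shift b) n)
    ≡⟨ factor (sign n) ((shift a ⋆ b) n) ((a ⋆ shift b) n) ⟩
  sign (suc n) ⊗ ((shift a ⋆ b) n ⊕ (a ⋆ shift b) n)
    ≡⟨ cong (sign (suc n) ⊗_) (sym (⋆-leibniz a b n)) ⟩
  sign (suc n) ⊗ (a ⋆ b) (suc n) ∎
  where
  regroup : ∀ s x → (⊝ 𝟙 ⊗ s) ⊗ x ≡ ⊝ 𝟙 ⊗ (s ⊗ x)
  regroup = solve-∀ ℚ√5-ring
  factor : ∀ s x y → ⊝ 𝟙 ⊗ (s ⊗ x) ⊕ ⊝ 𝟙 ⊗ (s ⊗ y) ≡ (⊝ 𝟙 ⊗ s) ⊗ (x ⊕ y)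
  factor = solve-∀ ℚ√5-ring

ones : ℕ → ℚ√5
ones = powers 𝟙

⋆-ones-fixed⇒zero : ∀ c → c ⋆ ones ≗ c → c ≗ λ _ → 𝟘
⋆-ones-fixed⇒zero c fixed n = step n (below n)
  where
  step : ∀ n → (∀ k → k < n → c k ≡ 𝟘) → c n ≡ 𝟘
  below : ∀ n k → k < n → c k ≡ 𝟘

  below zero k ()
  below (suc n) k (s≤s k≤n) with ℕₚ.m≤n⇒m<n∨m≡n k≤n
  ... | inj₁ k<n = below n k k<n
  ... | inj₂ refl = step k (below k)

  step n c<n≡0 = ℕ→-suc-cancel n (c n) (cancel (sym (begin
      c (suc n)                            ≡⟨ sym (fixed (suc n)) ⟩
      (c ⋆ ones) (suc n)                   ≡⟨ ∑-last (suc n) term ⟩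
      ∑ (suc n) term ⊕ term (suc n)        ≡⟨ cong₂ _⊕_ (∑-last n term) term-top ⟩
      (∑ n term ⊕ term n) ⊕ c (suc n)      ≡⟨ cong (λ s → (s ⊕ term n) ⊕ c (suc n)) (∑-zero n term term-low) ⟩
      (𝟘 ⊕ term n) ⊕ c (suc n)             ≡⟨ cong (λ t → (𝟘 ⊕ t) ⊕ c (suc n)) term-n ⟩
      (𝟘 ⊕ ℕ→ (suc n) ⊗ c n) ⊕ c (suc n)   ∎)))
    where
    term : ℕ → ℚ√5
    term = convolutionTerm c ones (suc n)
    times-𝟙 : ∀ x y → x ⊗ y ⊗ 𝟙 ≡ x ⊗ y
    times-𝟙 = solve-∀ ℚ√5-ring
    term-low : ∀ k → k < n → term k ≡ 𝟘
    term-low k k<n =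
      trans (cong (λ z → ℕ→ (suc n C k) ⊗ z ⊗ ones (suc n ∸ k)) (c<n≡0 k k<n))
            (trans (cong (_⊗ ones (suc n ∸ k)) (⊗-zeroʳ (ℕ→ (suc n C k)))) (⊗-zeroˡ (ones (suc n ∸ k))))
    term-n : term n ≡ ℕ→ (suc n) ⊗ c n
    term-n = trans (cong₂ (λ i e → ℕ→ i ⊗ c n ⊗ ones e) ([1+n]Cn≡1+n n) (ℕₚ.m+n∸n≡m 1 n))
                   (times-𝟙 (ℕ→ (suc n)) (c n))
    term-top : term (suc n) ≡ c (suc n)
    term-top = trans (cong₂ (λ i e → ℕ→ i ⊗ c (suc n) ⊗ ones e) (nCn≡1 (suc n)) (ℕₚ.n∸n≡0 n))
                     (trans (times-𝟙 𝟙 (c (suc n))) (⊗-identityˡ (c (suc n))))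
    cancel : ∀ {x y} → (𝟘 ⊕ x) ⊕ y ≡ y → x ≡ 𝟘
    cancel {x} {y} eq = trans (isolate x y) (trans (cong (_⊕ ⊝ y) eq) (⊝-inverseʳ y))
      where
      isolate : ∀ x y → x ≡ ((𝟘 ⊕ x) ⊕ y) ⊕ ⊝ y
      isolate = solve-∀ ℚ√5-ring

⋆-distribʳ-⊖ : ∀ a a′ b → (λ k → a k ⊖ a′ k) ⋆ b ≗ λ n → (a ⋆ b) n ⊖ (a′ ⋆ b) n
⋆-distribʳ-⊖ a a′ b n = begin
  ((λ k → a k ⊖ a′ k) ⋆ b) n
    ≡⟨ ⋆-congˡ {a′ = λ k → a k ⊕ ⊝ 𝟙 ⊗ a′ k} b (λ k → cong (a k ⊕_) (neg-as-scale (a′ k))) n ⟩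
  ((λ k → a k ⊕ ⊝ 𝟙 ⊗ a′ k) ⋆ b) n
    ≡⟨ ⋆-distribʳ-⊕ a (λ k → ⊝ 𝟙 ⊗ a′ k) b n ⟩
  (a ⋆ b) n ⊕ ((λ k → ⊝ 𝟙 ⊗ a′ k) ⋆ b) n
    ≡⟨ cong ((a ⋆ b) n ⊕_) (trans (⋆-scaleˡ (⊝ 𝟙) a′ b n) (sym (neg-as-scale ((a′ ⋆ b) n)))) ⟩
  (a ⋆ b) n ⊖ (a′ ⋆ b) n ∎
  where
  neg-as-scale : ∀ x → ⊝ x ≡ ⊝ 𝟙 ⊗ x
  neg-as-scale = solve-∀ ℚ√5-ring

⋆-ones-unique : ∀ (d u v : ℕ → ℚ√5) →
  (λ k → u k ⊖ d k) ⋆ ones ≗ u → (λ k → v k ⊖ d k) ⋆ ones ≗ v → u ≗ v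
⋆-ones-unique d u v u-fixed v-fixed n =
  difference-zero (u n) (v n) (⋆-ones-fixed⇒zero (λ k → u k ⊖ v k) fixed n)
  where
  cancel-d : ∀ x y z → (x ⊖ z) ⊖ (y ⊖ z) ≡ x ⊖ y
  cancel-d = solve-∀ ℚ√5-ring
  difference-zero : ∀ x y → x ⊖ y ≡ 𝟘 → x ≡ y
  difference-zero x y x-y≡0 = trans (add-back x y) (trans (cong (_⊕ y) x-y≡0) (⊕-identityˡ y))
    where
    add-back : ∀ x y → x ≡ (x ⊖ y) ⊕ y
    add-back = solve-∀ ℚ√5-ring
  fixed : (λ k → u k ⊖ v k) ⋆ ones ≗ λ k → u k ⊖ v k
  fixed m = begin
    ((λ k → u k ⊖ v k) ⋆ ones) m
      ≡⟨ ⋆-congˡ {a′ = λ k → (u k ⊖ d k) ⊖ (v k ⊖ d k)} ones (λ k → sym (cancel-d (u k) (v k) (d k))) m ⟩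
    ((λ k → (u k ⊖ d k) ⊖ (v k ⊖ d k)) ⋆ ones) m
      ≡⟨ ⋆-distribʳ-⊖ (λ k → u k ⊖ d k) (λ k → v k ⊖ d k) ones m ⟩
    ((λ k → u k ⊖ d k) ⋆ ones) m ⊖ ((λ k → v k ⊖ d k) ⋆ ones) m
      ≡⟨ cong₂ _⊖_ (u-fixed m) (v-fixed m) ⟩
    u m ⊖ v m ∎

B : ℕ → ℚ√5
B k = ι (bernoulli k)

-- The local definitions of the clause bernoulliList (suc n), so that it unfolds to
-- bernoulliList n ∷ʳ nextBernoulli n.
recurrenceSum : ℕ → ℚ
recurrenceSum n =
  foldr ℚ._+_ 0ℚ (zipWith (λ k b → (+ ((n ℕ.+ 2) C k) ℚ./ 1) ℚ.* b) (upTo (suc n)) (bernoulliList n))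

nextBernoulli : ℕ → ℚ
nextBernoulli n = ℚ.- (recurrenceSum n ℚ.* (+ 1 ℚ./ suc (suc n)))

nth-applyUpTo-∷ʳ : ∀ (f : ℕ → ℚ) m y → nth (applyUpTo f m ∷ʳ y) m ≡ y
nth-applyUpTo-∷ʳ f zero y = refl
nth-applyUpTo-∷ʳ f (suc m) y = nth-applyUpTo-∷ʳ (f ∘ suc) m y

bernoulliList≡applyUpTo : ∀ n → bernoulliList n ≡ applyUpTo bernoulli (suc n)
bernoulli-suc : ∀ n → bernoulli (suc n) ≡ nextBernoulli n

bernoulliList≡applyUpTo zero = refl
bernoulliList≡applyUpTo (suc n) = begin
  bernoulliList n ∷ʳ nextBernoulli n
    ≡⟨ cong₂ _∷ʳ_ (bernoulliList≡applyUpTo n) (sym (bernoulli-suc n)) ⟩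
  applyUpTo bernoulli (suc n) ∷ʳ bernoulli (suc n)
    ≡⟨ applyUpTo-∷ʳ bernoulli (suc n) ⟩
  applyUpTo bernoulli (suc (suc n)) ∎

bernoulli-suc n =
  trans (cong (λ bs → nth (bs ∷ʳ nextBernoulli n) (suc n)) (bernoulliList≡applyUpTo n))
        (nth-applyUpTo-∷ʳ bernoulli (suc n) (nextBernoulli n))

ι-foldr-zipWith : ∀ m (g : ℕ → ℚ → ℚ) (f : ℕ → ℕ) (h : ℕ → ℚ) →
  ι (foldr ℚ._+_ 0ℚ (zipWith g (applyUpTo f m) (applyUpTo h m))) ≡ ∑ m (λ k → ι (g (f k) (h k)))
ι-foldr-zipWith zero g f h = refl
ι-foldr-zipWith (suc m) g f h = cong (ι (g (f 0) (h 0)) ⊕_) (ι-foldr-zipWith m g (f ∘ suc) (h ∘ suc))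

recurrenceSum≡∑ : ∀ n → ι (recurrenceSum n) ≡ ∑ (suc n) (λ k → ℕ→ (suc (suc n) C k) ⊗ B k)
recurrenceSum≡∑ n = begin
  ι (recurrenceSum n)
    ≡⟨ cong (λ bs → ι (foldr ℚ._+_ 0ℚ (zipWith g (upTo (suc n)) bs))) (bernoulliList≡applyUpTo n) ⟩
  ι (foldr ℚ._+_ 0ℚ (zipWith g (upTo (suc n)) (applyUpTo bernoulli (suc n))))
    ≡⟨ ι-foldr-zipWith (suc n) g (λ k → k) bernoulli ⟩
  ∑ (suc n) (λ k → ι (g k (bernoulli k)))
    ≡⟨ ∑-cong (suc n) (λ k → trans (cong (λ m → ι (g′ m k (bernoulli k))) (ℕₚ.+-comm n 2))
                                   (ι-* (+ (suc (suc n) C k) ℚ./ 1) (bernoulli k))) ⟩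
  ∑ (suc n) (λ k → ℕ→ (suc (suc n) C k) ⊗ B k) ∎
  where
  g′ : ℕ → ℕ → ℚ → ℚ
  g′ m k b = (+ (m C k) ℚ./ 1) ℚ.* b
  g : ℕ → ℚ → ℚ
  g = g′ (n ℕ.+ 2)

bernoulli-recurrence : ∀ n → ∑ (suc (suc n)) (λ k → ℕ→ (suc (suc n) C k) ⊗ B k) ≡ 𝟘
bernoulli-recurrence n = begin
  ∑ (suc (suc n)) term
    ≡⟨ ∑-last (suc n) term ⟩
  ∑ (suc n) term ⊕ ℕ→ (suc (suc n) C suc n) ⊗ B (suc n)
    ≡⟨ cong₂ (λ s c → s ⊕ ℕ→ c ⊗ B (suc n)) (sym (recurrenceSum≡∑ n)) ([1+n]Cn≡1+n (suc n)) ⟩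
  ι s ⊕ ℕ→ (suc (suc n)) ⊗ B (suc n)
    ≡⟨ cong (ι s ⊕_) (trans (cong (ℕ→ (suc (suc n)) ⊗_) (cong ι (bernoulli-suc n)))
                            (sym (ι-* (+ suc (suc n) ℚ./ 1) (nextBernoulli n)))) ⟩
  ι (s ℚ.+ (+ suc (suc n) ℚ./ 1) ℚ.* nextBernoulli n)
    ≡⟨ cong ι (trans (regroup s (+ suc (suc n) ℚ./ 1) (+ 1 ℚ./ suc (suc n)))
                     (trans (cong (λ u → s ℚ.- s ℚ.* u) (+/1-inverse (suc n))) (cancel s))) ⟩
  𝟘 ∎
  where
  term : ℕ → ℚ√5
  term k = ℕ→ (suc (suc n) C k) ⊗ B k
  s = recurrenceSum n
  regroup : ∀ s q r → s ℚ.+ q ℚ.* (ℚ.- (s ℚ.* r)) ≡ s ℚ.- s ℚ.* (q ℚ.* r)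
  regroup = solve-∀ ℚ-ring
  cancel : ∀ s → s ℚ.- s ℚ.* 1ℚ ≡ 0ℚ
  cancel = solve-∀ ℚ-ring

δ₁ : ℕ → ℚ√5
δ₁ (suc zero) = 𝟙
δ₁ _ = 𝟘

bernoulli-⋆-ones : B ⋆ ones ≗ λ n → B n ⊕ δ₁ n
bernoulli-⋆-ones zero = refl
bernoulli-⋆-ones (suc zero) = refl
bernoulli-⋆-ones (suc (suc n)) = begin
  (B ⋆ ones) (suc (suc n))
    ≡⟨ ∑-last (suc (suc n)) term ⟩
  ∑ (suc (suc n)) term ⊕ term (suc (suc n))
    ≡⟨ cong₂ _⊕_ (trans (∑-cong (suc (suc n)) drop-ones) (bernoulli-recurrence n)) top ⟩
  𝟘 ⊕ B (suc (suc n))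
    ≡⟨ ⊕-comm 𝟘 (B (suc (suc n))) ⟩
  B (suc (suc n)) ⊕ 𝟘 ∎
  where
  term : ℕ → ℚ√5
  term k = ℕ→ (suc (suc n) C k) ⊗ B k ⊗ ones (suc (suc n) ∸ k)
  times-𝟙 : ∀ c x → c ⊗ x ⊗ 𝟙 ≡ c ⊗ x
  times-𝟙 = solve-∀ ℚ√5-ring
  drop-ones : ∀ k → term k ≡ ℕ→ (suc (suc n) C k) ⊗ B k
  drop-ones k = trans (cong (ℕ→ (suc (suc n) C k) ⊗ B k ⊗_) (𝟙^ℕ (suc (suc n) ∸ k)))
                      (times-𝟙 (ℕ→ (suc (suc n) C k)) (B k))
  top : term (suc (suc n)) ≡ B (suc (suc n))
  top = trans (cong₂ (λ c e → ℕ→ c ⊗ B (suc (suc n)) ⊗ ones e) (nCn≡1 (suc (suc n))) (ℕₚ.n∸n≡0 n))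
              (trans (times-𝟙 𝟙 (B (suc (suc n)))) (⊗-identityˡ (B (suc (suc n)))))

sign-δ₁ : ∀ n → sign n ⊗ δ₁ n ≡ ⊝ δ₁ n
sign-δ₁ zero = refl
sign-δ₁ (suc zero) = refl
sign-δ₁ (suc (suc n)) = ⊗-zeroʳ (sign (suc (suc n)))

-- With δ₁ standing for z: B(z)e^z = B(z) + z, hence B(-z)e^{-z} = B(-z) - z, so both B(z)e^z and
-- B(-z) solve X = (X - z)e^z, whose solution is unique because X e^z = X forces X = 0.
bernoulli-⋆-ones≗twist : B ⋆ ones ≗ twist B
bernoulli-⋆-ones≗twist = ⋆-ones-unique δ₁ (B ⋆ ones) (twist B) ⋆-ones-solves twist-solves
  where
  ⋆-ones-solves : (λ k → (B ⋆ ones) k ⊖ δ₁ k) ⋆ ones ≗ B ⋆ ones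
  ⋆-ones-solves = ⋆-congˡ {a′ = B} ones (λ k → trans (cong (_⊖ δ₁ k) (bernoulli-⋆-ones k)) (cancel (B k) (δ₁ k)))
    where
    cancel : ∀ x y → (x ⊕ y) ⊖ y ≡ x
    cancel = solve-∀ ℚ√5-ring
  twist-ones : twist ones ≗ powers (⊝ 𝟙)
  twist-ones k = trans (cong (sign k ⊗_) (𝟙^ℕ k)) (⊗-identityʳ (sign k))
  twist-split : twist B ⋆ twist ones ≗ λ k → twist B k ⊖ δ₁ k
  twist-split k = begin
    (twist B ⋆ twist ones) k       ≡⟨ twist-⋆-twist B ones k ⟩
    sign k ⊗ (B ⋆ ones) k          ≡⟨ cong (sign k ⊗_) (bernoulli-⋆-ones k) ⟩
    sign k ⊗ (B k ⊕ δ₁ k)          ≡⟨ ⊗-distribˡ-⊕ (sign k) (B k) (δ₁ k) ⟩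
    twist B k ⊕ sign k ⊗ δ₁ k      ≡⟨ cong (twist B k ⊕_) (sign-δ₁ k) ⟩
    twist B k ⊖ δ₁ k               ∎
  twist-solves : (λ k → twist B k ⊖ δ₁ k) ⋆ ones ≗ twist B
  twist-solves k = begin
    ((λ k → twist B k ⊖ δ₁ k) ⋆ ones) k      ≡⟨ ⋆-congˡ ones (λ i → sym (twist-split i)) k ⟩
    ((twist B ⋆ twist ones) ⋆ ones) k        ≡⟨ ⋆-assoc (twist B) (twist ones) ones k ⟩
    (twist B ⋆ (twist ones ⋆ ones)) k        ≡⟨ ⋆-congʳ (twist B) (λ i → trans (⋆-congˡ ones twist-ones i)
                                                                           (powers-⋆-powers (⊝ 𝟙) 𝟙 i)) k ⟩
    (twist B ⋆ powers 𝟘) k                   ≡⟨ ⋆-comm (twist B) (powers 𝟘) k ⟩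
    (powers 𝟘 ⋆ twist B) k                   ≡⟨ ⋆-identityˡ (twist B) k ⟩
    twist B k                                ∎

bernoulliPoly≡⋆ : ∀ n x → bernoulliPoly n x ≡ (B ⋆ powers x) n
bernoulliPoly≡⋆ n x = Σ[0⋯]≡∑ n (λ k → ℕ→ (n C k) ⊗ B k ⊗ x ^ℕ (n ∸ k))

bernoulliPoly-reflection : ∀ n x → bernoulliPoly n (𝟙 ⊖ x) ≡ sign n ⊗ bernoulliPoly n x
bernoulliPoly-reflection n x = begin
  bernoulliPoly n (𝟙 ⊖ x)                ≡⟨ bernoulliPoly≡⋆ n (𝟙 ⊖ x) ⟩
  (B ⋆ powers (𝟙 ⊖ x)) n                 ≡⟨ ⋆-congʳ B (λ k → sym (powers-⋆-powers 𝟙 (⊝ x) k)) n ⟩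
  (B ⋆ (ones ⋆ powers (⊝ x))) n          ≡⟨ sym (⋆-assoc B ones (powers (⊝ x)) n) ⟩
  ((B ⋆ ones) ⋆ powers (⊝ x)) n          ≡⟨ ⋆-cong bernoulli-⋆-ones≗twist (^ℕ-neg x) n ⟩
  (twist B ⋆ twist (powers x)) n         ≡⟨ twist-⋆-twist B (powers x) n ⟩
  sign n ⊗ (B ⋆ powers x) n              ≡⟨ cong (sign n ⊗_) (sym (bernoulliPoly≡⋆ n x)) ⟩
  sign n ⊗ bernoulliPoly n x             ∎

⋆-bernoulli-conjugate-powers : ∀ n x p q →
  ((λ k → p ⊗ x ^ℕ k ⊕ q ⊗ (𝟙 ⊖ x) ^ℕ k) ⋆ B) n ≡ (p ⊕ q ⊗ sign n) ⊗ bernoulliPoly n x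
⋆-bernoulli-conjugate-powers n x p q = begin
  ((λ k → p ⊗ x ^ℕ k ⊕ q ⊗ (𝟙 ⊖ x) ^ℕ k) ⋆ B) n
    ≡⟨ ⋆-distribʳ-⊕ (λ k → p ⊗ x ^ℕ k) (λ k → q ⊗ (𝟙 ⊖ x) ^ℕ k) B n ⟩
  ((λ k → p ⊗ x ^ℕ k) ⋆ B) n ⊕ ((λ k → q ⊗ (𝟙 ⊖ x) ^ℕ k) ⋆ B) n
    ≡⟨ cong₂ _⊕_ (⋆-scaleˡ p (powers x) B n) (⋆-scaleˡ q (powers (𝟙 ⊖ x)) B n) ⟩
  p ⊗ (powers x ⋆ B) n ⊕ q ⊗ (powers (𝟙 ⊖ x) ⋆ B) n
    ≡⟨ cong₂ (λ u v → p ⊗ u ⊕ q ⊗ v) (as-poly x) (as-poly (𝟙 ⊖ x)) ⟩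
  p ⊗ bernoulliPoly n x ⊕ q ⊗ bernoulliPoly n (𝟙 ⊖ x)
    ≡⟨ cong (λ v → p ⊗ bernoulliPoly n x ⊕ q ⊗ v) (bernoulliPoly-reflection n x) ⟩
  p ⊗ bernoulliPoly n x ⊕ q ⊗ (sign n ⊗ bernoulliPoly n x)
    ≡⟨ factor p q (sign n) (bernoulliPoly n x) ⟩
  (p ⊕ q ⊗ sign n) ⊗ bernoulliPoly n x ∎
  where
  as-poly : ∀ y → (powers y ⋆ B) n ≡ bernoulliPoly n y
  as-poly y = trans (⋆-comm (powers y) B n) (sym (bernoulliPoly≡⋆ n y))
  factor : ∀ p q s P → p ⊗ P ⊕ q ⊗ (s ⊗ P) ≡ (p ⊕ q ⊗ s) ⊗ P
  factor = solve-∀ ℚ√5-ring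

norm : ℚ√5 → ℚ
norm (a +√5· b) = a ℚ.* a ℚ.- five ℚ.* (b ℚ.* b)

norm-⊗ : ∀ x y → norm (x ⊗ y) ≡ norm x ℚ.* norm y
norm-⊗ (a +√5· b) (c +√5· d) = multiplicative a b c d five
  where
  multiplicative : ∀ a b c d k →
    (a ℚ.* c ℚ.+ k ℚ.* (b ℚ.* d)) ℚ.* (a ℚ.* c ℚ.+ k ℚ.* (b ℚ.* d))
      ℚ.- k ℚ.* ((a ℚ.* d ℚ.+ b ℚ.* c) ℚ.* (a ℚ.* d ℚ.+ b ℚ.* c))
      ≡ (a ℚ.* a ℚ.- k ℚ.* (b ℚ.* b)) ℚ.* (c ℚ.* c ℚ.- k ℚ.* (d ℚ.* d))
  multiplicative = solve-∀ ℚ-ring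

⊗-inverseʳ : ∀ x y → x ⊗ y ≡ 𝟙 → x ⊗ inv x ≡ 𝟙
⊗-inverseʳ (a +√5· b) y xy≡1 with norm (a +√5· b) ℚₚ.≟ 0ℚ
... | yes norm≡0 = ⊥-elim (ℚₚ.1≢0 (begin
  1ℚ                           ≡⟨ sym (cong norm xy≡1) ⟩
  norm ((a +√5· b) ⊗ y)        ≡⟨ norm-⊗ (a +√5· b) y ⟩
  norm (a +√5· b) ℚ.* norm y   ≡⟨ cong (ℚ._* norm y) norm≡0 ⟩
  0ℚ ℚ.* norm y                ≡⟨ ℚₚ.*-zeroˡ (norm y) ⟩
  0ℚ                           ∎))
... | no norm≢0 = cong₂ _+√5·_ (trans (re-inverse a b m five) (ℚₚ.*-inverseʳ N)) (im-inverse a b m)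
  where
  N = norm (a +√5· b)
  instance
    N-nonZero : ℚ.NonZero N
    N-nonZero = ℚ.≢-nonZero norm≢0
  m = ℚ.1/ N
  re-inverse : ∀ a b m k →
    a ℚ.* (a ℚ.* m) ℚ.+ k ℚ.* (b ℚ.* (ℚ.- (b ℚ.* m))) ≡ (a ℚ.* a ℚ.- k ℚ.* (b ℚ.* b)) ℚ.* m
  re-inverse = solve-∀ ℚ-ring
  im-inverse : ∀ a b m → a ℚ.* (ℚ.- (b ℚ.* m)) ℚ.+ b ℚ.* (a ℚ.* m) ≡ 0ℚ
  im-inverse = solve-∀ ℚ-ring

inv-unique : ∀ x y → x ⊗ y ≡ 𝟙 → inv x ≡ y
inv-unique x y xy≡1 = begin
  inv x               ≡⟨ sym (⊗-identityʳ (inv x)) ⟩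
  inv x ⊗ 𝟙           ≡⟨ cong (inv x ⊗_) (sym xy≡1) ⟩
  inv x ⊗ (x ⊗ y)     ≡⟨ regroup (inv x) x y ⟩
  (x ⊗ inv x) ⊗ y     ≡⟨ cong (_⊗ y) (⊗-inverseʳ x y xy≡1) ⟩
  𝟙 ⊗ y               ≡⟨ ⊗-identityˡ y ⟩
  y                   ∎
  where
  regroup : ∀ a b c → a ⊗ (b ⊗ c) ≡ (b ⊗ a) ⊗ c
  regroup = solve-∀ ℚ√5-ring

module IntegerPowers (x : ℚ√5) (x⊗inv-x≡𝟙 : x ⊗ inv x ≡ 𝟙) where

  ^ℤ-suc : ∀ z → x ^ℤ ℤ.suc z ≡ x ⊗ x ^ℤ z
  ^ℤ-suc (+ n) = refl
  ^ℤ-suc -[1+ zero ] = trans (sym x⊗inv-x≡𝟙) (cong (x ⊗_) (sym (⊗-identityʳ (inv x))))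
  ^ℤ-suc -[1+ suc n ] = begin
    inv x ^ℕ suc n                     ≡⟨ sym (⊗-identityˡ (inv x ^ℕ suc n)) ⟩
    𝟙 ⊗ inv x ^ℕ suc n                 ≡⟨ cong (_⊗ inv x ^ℕ suc n) (sym x⊗inv-x≡𝟙) ⟩
    (x ⊗ inv x) ⊗ inv x ^ℕ suc n       ≡⟨ ⊗-assoc x (inv x) (inv x ^ℕ suc n) ⟩
    x ⊗ inv x ^ℕ suc (suc n)           ∎

  ^ℤ-pred : ∀ z → x ^ℤ ℤ.pred z ≡ inv x ⊗ x ^ℤ z
  ^ℤ-pred (+ zero) = refl
  ^ℤ-pred (+ suc n) = begin
    x ^ℕ n                     ≡⟨ sym (⊗-identityˡ (x ^ℕ n)) ⟩
    𝟙 ⊗ x ^ℕ n                 ≡⟨ cong (_⊗ x ^ℕ n) (sym (trans (⊗-comm (inv x) x) x⊗inv-x≡𝟙)) ⟩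
    (inv x ⊗ x) ⊗ x ^ℕ n       ≡⟨ ⊗-assoc (inv x) x (x ^ℕ n) ⟩
    inv x ⊗ x ^ℕ suc n         ∎
  ^ℤ-pred -[1+ n ] = refl

  ^ℤ-distribˡ-+ : ∀ a b → x ^ℤ (a ℤ.+ b) ≡ x ^ℤ a ⊗ x ^ℤ b
  ^ℤ-distribˡ-+ a (+ zero) = trans (cong (x ^ℤ_) (ℤₚ.+-identityʳ a)) (sym (⊗-identityʳ (x ^ℤ a)))
  ^ℤ-distribˡ-+ a (+ suc n) = begin
    x ^ℤ (a ℤ.+ + suc n)        ≡⟨ cong (x ^ℤ_) +-suc ⟩
    x ^ℤ ℤ.suc (a ℤ.+ + n)      ≡⟨ ^ℤ-suc (a ℤ.+ + n) ⟩
    x ⊗ x ^ℤ (a ℤ.+ + n)        ≡⟨ cong (x ⊗_) (^ℤ-distribˡ-+ a (+ n)) ⟩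
    x ⊗ (x ^ℤ a ⊗ x ^ℕ n)       ≡⟨ left-comm x (x ^ℤ a) (x ^ℕ n) ⟩
    x ^ℤ a ⊗ x ^ℕ suc n         ∎
    where
    +-suc : a ℤ.+ + suc n ≡ ℤ.suc (a ℤ.+ + n)
    +-suc = trans (ℤₚ.+-comm a (+ suc n)) (trans (ℤₚ.suc-+ n a) (cong ℤ.suc (ℤₚ.+-comm (+ n) a)))
    left-comm : ∀ p q r → p ⊗ (q ⊗ r) ≡ q ⊗ (p ⊗ r)
    left-comm = solve-∀ ℚ√5-ring
  ^ℤ-distribˡ-+ a -[1+ zero ] =
    trans (cong (x ^ℤ_) (ℤₚ.+-comm a ℤ.-1ℤ)) (trans (^ℤ-pred a) (reorder (inv x) (x ^ℤ a)))
    where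
    reorder : ∀ p q → p ⊗ q ≡ q ⊗ (p ⊗ 𝟙)
    reorder = solve-∀ ℚ√5-ring
  ^ℤ-distribˡ-+ a -[1+ suc n ] = begin
    x ^ℤ (a ℤ.+ ℤ.pred -[1+ n ])           ≡⟨ cong (x ^ℤ_) (ℤₚ.+-pred a -[1+ n ]) ⟩
    x ^ℤ ℤ.pred (a ℤ.+ -[1+ n ])           ≡⟨ ^ℤ-pred (a ℤ.+ -[1+ n ]) ⟩
    inv x ⊗ x ^ℤ (a ℤ.+ -[1+ n ])          ≡⟨ cong (inv x ⊗_) (^ℤ-distribˡ-+ a -[1+ n ]) ⟩
    inv x ⊗ (x ^ℤ a ⊗ inv x ^ℕ suc n)      ≡⟨ left-comm (inv x) (x ^ℤ a) (inv x ^ℕ suc n) ⟩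
    x ^ℤ a ⊗ inv x ^ℕ suc (suc n)          ∎
    where
    left-comm : ∀ p q r → p ⊗ (q ⊗ r) ≡ q ⊗ (p ⊗ r)
    left-comm = solve-∀ ℚ√5-ring

  ^ℤ-*-assoc : ∀ j k → x ^ℤ (j * + k) ≡ (x ^ℤ j) ^ℕ k
  ^ℤ-*-assoc j zero = cong (x ^ℤ_) (ℤₚ.*-zeroʳ j)
  ^ℤ-*-assoc j (suc k) =
    trans (cong (x ^ℤ_) (ℤₚ.*-suc j (+ k)))
          (trans (^ℤ-distribˡ-+ j (j * + k)) (cong (x ^ℤ j ⊗_) (^ℤ-*-assoc j k)))

  ^ℤ-pred-inv : ∀ s → x ^ℤ (s - + 1) ≡ x ^ℤ s ⊗ inv x
  ^ℤ-pred-inv s = trans (^ℤ-distribˡ-+ s ℤ.-1ℤ) (cong (x ^ℤ s ⊗_) (⊗-identityʳ (inv x)))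

module α-Powers = IntegerPowers α refl
module β-Powers = IntegerPowers β refl

conj : ℚ√5 → ℚ√5
conj (a +√5· b) = a +√5· (ℚ.- b)

conj-⊗ : ∀ x y → conj (x ⊗ y) ≡ conj x ⊗ conj y
conj-⊗ (a +√5· b) (c +√5· d) = cong₂ _+√5·_ (re-conj a b c d five) (im-conj a b c d)
  where
  re-conj : ∀ a b c d k → a ℚ.* c ℚ.+ k ℚ.* (b ℚ.* d) ≡ a ℚ.* c ℚ.+ k ℚ.* ((ℚ.- b) ℚ.* (ℚ.- d))
  re-conj = solve-∀ ℚ-ring
  im-conj : ∀ a b c d → ℚ.- (a ℚ.* d ℚ.+ b ℚ.* c) ≡ a ℚ.* (ℚ.- d) ℚ.+ (ℚ.- b) ℚ.* c
  im-conj = solve-∀ ℚ-ring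

conj-^ℕ : ∀ x k → conj (x ^ℕ k) ≡ conj x ^ℕ k
conj-^ℕ x zero = refl
conj-^ℕ x (suc k) = trans (conj-⊗ x (x ^ℕ k)) (cong (conj x ⊗_) (conj-^ℕ x k))

⊕-conj : ∀ x → x ⊕ conj x ≡ ι (re x ℚ.+ re x)
⊕-conj (a +√5· b) = cong ((a ℚ.+ a) +√5·_) (ℚₚ.+-inverseʳ b)

PositiveCoordinates : ℚ√5 → Set
PositiveCoordinates x = ℚ.Positive (re x) × ℚ.NonNegative (im x)

α-⊗-positive : ∀ x → PositiveCoordinates x → PositiveCoordinates (α ⊗ x)
α-⊗-positive (a +√5· b) (a>0 , b≥0) =
  ℚₚ.pos+nonNeg⇒pos (½ ℚ.* a) {{ℚₚ.pos*pos⇒pos ½ a {{a>0}}}}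
                    (five ℚ.* (½ ℚ.* b)) {{ℚₚ.nonNeg*nonNeg⇒nonNeg five (½ ℚ.* b) {{½b≥0}}}}
  , ℚₚ.nonNeg+nonNeg⇒nonNeg (½ ℚ.* b) {{½b≥0}}
                            (½ ℚ.* a) {{ℚₚ.nonNeg*nonNeg⇒nonNeg ½ a {{ℚₚ.pos⇒nonNeg a {{a>0}}}}}}
  where
  ½ : ℚ
  ½ = 1ℚ ℚ.÷ (+ 2 ℚ./ 1)
  ½b≥0 : ℚ.NonNegative (½ ℚ.* b)
  ½b≥0 = ℚₚ.nonNeg*nonNeg⇒nonNeg ½ b {{b≥0}}

α^ℕ-positive : ∀ m → PositiveCoordinates (α ^ℕ m)
α^ℕ-positive zero = _ , _
α^ℕ-positive (suc m) = α-⊗-positive (α ^ℕ m) (α^ℕ-positive m)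

L-ℕ-invertible : ∀ m → ∃ λ y → L (+ m) ⊗ y ≡ 𝟙
L-ℕ-invertible m = ι (ℚ.1/ r) , (begin
  (α ^ℕ m ⊕ β ^ℕ m) ⊗ ι (ℚ.1/ r)           ≡⟨ cong (λ z → (α ^ℕ m ⊕ z) ⊗ ι (ℚ.1/ r)) (sym (conj-^ℕ α m)) ⟩
  (α ^ℕ m ⊕ conj (α ^ℕ m)) ⊗ ι (ℚ.1/ r)    ≡⟨ cong (_⊗ ι (ℚ.1/ r)) (⊕-conj (α ^ℕ m)) ⟩
  ι r ⊗ ι (ℚ.1/ r)                         ≡⟨ sym (ι-* r (ℚ.1/ r)) ⟩
  ι (r ℚ.* ℚ.1/ r)                         ≡⟨ cong ι (ℚₚ.*-inverseʳ r) ⟩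
  𝟙                                        ∎)
  where
  a = re (α ^ℕ m)
  r = a ℚ.+ a
  instance
    r-nonZero : ℚ.NonZero r
    r-nonZero = ℚₚ.pos⇒nonZero r {{ℚₚ.pos+pos⇒pos a {{proj₁ (α^ℕ-positive m)}} a {{proj₁ (α^ℕ-positive m)}}}}

L-invertible : ∀ j → ∃ λ y → L j ⊗ y ≡ 𝟙
L-invertible (+ m) = L-ℕ-invertible m
L-invertible -[1+ m ] = sign k ⊗ y , (begin
  ((⊝ β) ^ℕ k ⊕ (⊝ α) ^ℕ k) ⊗ (sign k ⊗ y)
    ≡⟨ cong₂ (λ u v → (u ⊕ v) ⊗ (sign k ⊗ y)) (^ℕ-neg β k) (^ℕ-neg α k) ⟩
  (sign k ⊗ β ^ℕ k ⊕ sign k ⊗ α ^ℕ k) ⊗ (sign k ⊗ y)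
    ≡⟨ regroup (sign k) (α ^ℕ k) (β ^ℕ k) y ⟩
  (sign k ⊗ sign k) ⊗ ((α ^ℕ k ⊕ β ^ℕ k) ⊗ y)
    ≡⟨ cong₂ _⊗_ (sign-square k) (proj₂ (L-ℕ-invertible k)) ⟩
  𝟙 ∎)
  where
  k = suc m
  y = proj₁ (L-ℕ-invertible k)
  regroup : ∀ s a b y → (s ⊗ b ⊕ s ⊗ a) ⊗ (s ⊗ y) ≡ (s ⊗ s) ⊗ ((a ⊕ b) ⊗ y)
  regroup = solve-∀ ℚ√5-ring

L-inverseʳ : ∀ j → L j ⊗ inv (L j) ≡ 𝟙
L-inverseʳ j = ⊗-inverseʳ (L j) (proj₁ (L-invertible j)) (proj₂ (L-invertible j))

β^ℤ⊘L≡𝟙⊖α^ℤ⊘L : ∀ j → β ^ℤ j ⊘ L j ≡ 𝟙 ⊖ α ^ℤ j ⊘ L j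
β^ℤ⊘L≡𝟙⊖α^ℤ⊘L j =
  trans (isolate (α ^ℤ j) (β ^ℤ j) (inv (L j))) (cong (_⊖ α ^ℤ j ⊘ L j) (L-inverseʳ j))
  where
  isolate : ∀ u v w → v ⊗ w ≡ (u ⊕ v) ⊗ w ⊖ u ⊗ w
  isolate = solve-∀ ℚ√5-ring

inv-^ℕ : ∀ x k → x ⊗ inv x ≡ 𝟙 → inv (x ^ℕ k) ≡ inv x ^ℕ k
inv-^ℕ x k x⊗inv-x≡𝟙 =
  inv-unique (x ^ℕ k) (inv x ^ℕ k)
             (trans (sym (^ℕ-distribʳ-⊗ x (inv x) k)) (trans (cong (_^ℕ k) x⊗inv-x≡𝟙) (𝟙^ℕ k)))

binet-⊘-L^ℕ : ∀ j k c d →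
  (α ^ℤ (j * + k) ⊗ c ⊕ β ^ℤ (j * + k) ⊗ d) ⊘ (L j ^ℕ k)
    ≡ c ⊗ (α ^ℤ j ⊘ L j) ^ℕ k ⊕ d ⊗ (β ^ℤ j ⊘ L j) ^ℕ k
binet-⊘-L^ℕ j k c d = begin
  (α ^ℤ (j * + k) ⊗ c ⊕ β ^ℤ (j * + k) ⊗ d) ⊘ (L j ^ℕ k)
    ≡⟨ cong₂ (λ u v → (u ⊗ c ⊕ v ⊗ d) ⊘ (L j ^ℕ k)) (α-Powers.^ℤ-*-assoc j k) (β-Powers.^ℤ-*-assoc j k) ⟩
  ((α ^ℤ j) ^ℕ k ⊗ c ⊕ (β ^ℤ j) ^ℕ k ⊗ d) ⊗ inv (L j ^ℕ k)
    ≡⟨ cong (((α ^ℤ j) ^ℕ k ⊗ c ⊕ (β ^ℤ j) ^ℕ k ⊗ d) ⊗_) (inv-^ℕ (L j) k (L-inverseʳ j)) ⟩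
  ((α ^ℤ j) ^ℕ k ⊗ c ⊕ (β ^ℤ j) ^ℕ k ⊗ d) ⊗ w ^ℕ k
    ≡⟨ distribute ((α ^ℤ j) ^ℕ k) ((β ^ℤ j) ^ℕ k) (w ^ℕ k) c d ⟩
  c ⊗ ((α ^ℤ j) ^ℕ k ⊗ w ^ℕ k) ⊕ d ⊗ ((β ^ℤ j) ^ℕ k ⊗ w ^ℕ k)
    ≡⟨ sym (cong₂ (λ u v → c ⊗ u ⊕ d ⊗ v) (^ℕ-distribʳ-⊗ (α ^ℤ j) w k) (^ℕ-distribʳ-⊗ (β ^ℤ j) w k)) ⟩
  c ⊗ (α ^ℤ j ⊘ L j) ^ℕ k ⊕ d ⊗ (β ^ℤ j ⊘ L j) ^ℕ k ∎
  where
  w = inv (L j)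
  distribute : ∀ u v w c d → (u ⊗ c ⊕ v ⊗ d) ⊗ w ≡ c ⊗ (u ⊗ w) ⊕ d ⊗ (v ⊗ w)
  distribute = solve-∀ ℚ√5-ring

F-binet : ∀ s → F s ≡ α ^ℤ s ⊗ inv √5 ⊕ β ^ℤ s ⊗ ⊝ inv √5
F-binet s = distribute (α ^ℤ s) (β ^ℤ s) (inv √5)
  where
  distribute : ∀ u v i → (u ⊖ v) ⊗ i ≡ u ⊗ i ⊕ v ⊗ ⊝ i
  distribute = solve-∀ ℚ√5-ring

-- inv α and inv β compute to ⊝ β and ⊝ α.
F-pred-binet : ∀ s → F (s - + 1) ≡ α ^ℤ s ⊗ (⊝ β ⊘ √5) ⊕ β ^ℤ s ⊗ (α ⊘ √5)
F-pred-binet s =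
  trans (cong₂ (λ u v → (u ⊖ v) ⊘ √5) (α-Powers.^ℤ-pred-inv s) (β-Powers.^ℤ-pred-inv s))
        (distribute (α ^ℤ s) (β ^ℤ s) (⊝ β) (⊝ α) (inv √5))
  where
  distribute : ∀ u v p q i → (u ⊗ p ⊖ v ⊗ q) ⊗ i ≡ u ⊗ (p ⊗ i) ⊕ v ⊗ (⊝ q ⊗ i)
  distribute = solve-∀ ℚ√5-ring

L-binet : ∀ s → L s ≡ α ^ℤ s ⊗ 𝟙 ⊕ β ^ℤ s ⊗ 𝟙
L-binet s = sym (cong₂ _⊕_ (⊗-identityʳ (α ^ℤ s)) (⊗-identityʳ (β ^ℤ s)))

L-pred-binet : ∀ s → L (s - + 1) ≡ α ^ℤ s ⊗ ⊝ β ⊕ β ^ℤ s ⊗ ⊝ α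
L-pred-binet s = cong₂ _⊕_ (α-Powers.^ℤ-pred-inv s) (β-Powers.^ℤ-pred-inv s)

Σ-binet-bernoulli : ∀ j n (f : ℕ → ℚ√5) c d {s r} →
  (∀ k → f k ≡ α ^ℤ (j * + k) ⊗ c ⊕ β ^ℤ (j * + k) ⊗ d) → sign n ≡ s → c ⊕ d ⊗ s ≡ r →
  Σ[ 0 ⋯ n ] (λ k → ℕ→ (n C k) ⊗ (f k ⊘ (L j ^ℕ k)) ⊗ B (n ∸ k)) ≡ r ⊗ bernoulliPoly n (α ^ℤ j ⊘ L j)
Σ-binet-bernoulli j n f c d {s} {r} binet sign≡s coefficient = begin
  Σ[ 0 ⋯ n ] (λ k → ℕ→ (n C k) ⊗ (f k ⊘ (L j ^ℕ k)) ⊗ B (n ∸ k))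
    ≡⟨ Σ[0⋯]≡∑ n (λ k → ℕ→ (n C k) ⊗ (f k ⊘ (L j ^ℕ k)) ⊗ B (n ∸ k)) ⟩
  ((λ k → f k ⊘ (L j ^ℕ k)) ⋆ B) n
    ≡⟨ ⋆-congˡ B powers-form n ⟩
  ((λ k → c ⊗ x ^ℕ k ⊕ d ⊗ (𝟙 ⊖ x) ^ℕ k) ⋆ B) n
    ≡⟨ ⋆-bernoulli-conjugate-powers n x c d ⟩
  (c ⊕ d ⊗ sign n) ⊗ bernoulliPoly n x
    ≡⟨ cong (λ e → (c ⊕ d ⊗ e) ⊗ bernoulliPoly n x) sign≡s ⟩
  (c ⊕ d ⊗ s) ⊗ bernoulliPoly n x
    ≡⟨ cong (_⊗ bernoulliPoly n x) coefficient ⟩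
  r ⊗ bernoulliPoly n x ∎
  where
  x = α ^ℤ j ⊘ L j
  powers-form : (λ k → f k ⊘ (L j ^ℕ k)) ≗ λ k → c ⊗ x ^ℕ k ⊕ d ⊗ (𝟙 ⊖ x) ^ℕ k
  powers-form k = trans (cong (_⊘ (L j ^ℕ k)) (binet k))
                        (trans (binet-⊘-L^ℕ j k c d)
                               (cong (λ y → c ⊗ x ^ℕ k ⊕ d ⊗ y ^ℕ k) (β^ℤ⊘L≡𝟙⊖α^ℤ⊘L j)))

F-j*0-term : ∀ j c b → c ⊗ (F (j * + 0) ⊘ (L j ^ℕ 0)) ⊗ b ≡ 𝟘
F-j*0-term j c b =
  trans (cong (λ t → c ⊗ (F t ⊘ 𝟙) ⊗ b) (ℤₚ.*-zeroʳ j)) (trans (cong (_⊗ b) (⊗-zeroʳ c)) (⊗-zeroˡ b))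

corollary13 : (j : ℤ) (n : ℕ) →
  (Even n →
    (Σ[ 0 ⋯ n ] (λ k → ℕ→ (n C k) ⊗ (F (j * + k - + 1) ⊘ (L j ^ℕ k)) ⊗ ι (bernoulli (n ∸ k)))
      ≡ bernoulliPoly n (α ^ℤ j ⊘ L j))
    × (Σ[ 1 ⋯ n ] (λ k → ℕ→ (n C k) ⊗ (F (j * + k) ⊘ (L j ^ℕ k)) ⊗ ι (bernoulli (n ∸ k)))
      ≡ 𝟘))
  × (Odd n →
    (Σ[ 0 ⋯ n ] (λ k → ℕ→ (n C k) ⊗ (L (j * + k - + 1) ⊘ (L j ^ℕ k)) ⊗ ι (bernoulli (n ∸ k)))
      ≡ √5 ⊗ bernoulliPoly n (α ^ℤ j ⊘ L j))
    × (Σ[ 0 ⋯ n ] (λ k → ℕ→ (n C k) ⊗ (L (j * + k) ⊘ (L j ^ℕ k)) ⊗ ι (bernoulli (n ∸ k)))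
      ≡ 𝟘))
corollary13 j n =
  (λ even →
       trans (Σ-binet-bernoulli j n _ _ _ (F-pred-binet ∘ jk) (sign-even even) refl) (⊗-identityˡ P)
     , trans (Σ[1⋯]≡Σ[0⋯] n (λ k → ℕ→ (n C k) ⊗ (F (jk k) ⊘ (L j ^ℕ k)) ⊗ B (n ∸ k))
                          (F-j*0-term j (ℕ→ (n C 0)) (B n)))
             (trans (Σ-binet-bernoulli j n _ _ _ (F-binet ∘ jk) (sign-even even) refl) (⊗-zeroˡ P)))
  , (λ odd →
       Σ-binet-bernoulli j n _ _ _ (L-pred-binet ∘ jk) (sign-odd odd) refl
     , trans (Σ-binet-bernoulli j n _ _ _ (L-binet ∘ jk) (sign-odd odd) refl) (⊗-zeroˡ P))
  where
  jk : ℕ → ℤ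
  jk k = j * + k
  P = bernoulliPoly n (α ^ℤ j ⊘ L j)
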